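{- Let $G$ be a finite simple graph with $n$ vertices and $m\ge 1$ edges. Then \[NK(G^{ --- }) \le \left[(m+n-1)-\frac{4m}{n}\right]^{n}\left[(m+n-1)-\frac{1}{m}M_1(G)\right]^{m},\] with equality if and only if $G$ is a regular graph.
   Context: For a graph $H$, $NK(H)=\prod_{v\in V(H)} d_H(v)$ (Narumi-Katayama index). $M_1(G)=\sum_{v\in V(G)}d_G(v)^2=\sum_{uv\in E(G)}[d_G(u)+d_G(v)]$ is the first Zagreb index. For $x,y,z\in\{+,-\}$ the total transformation graph $G^{xyz}$ has vertex set $V(G)\cup E(G)$ (disjoint union) and two distinct vertices are adjacent as follows: two vertices of $G$ are adjacent iff they are adjacent in $G$ (if $x=+$), resp. non-adjacent in $G$ (if $x=-$); two edges of $G$ are adjacent iff they share an endpoint in $G$ (if $y=+$), resp. share no endpoint (if $y=-$); a vertex $u$ and an edge $e$ of $G$ are adjacent iff $u$ is incident to $e$ (if $z=+$), resp. not incident (if $z=-$). -}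

module Defs where

open import Data.Bool using (Bool; true; false; not; _∧_; _∨_; if_then_else_)
open import Data.Nat using (ℕ; zero; suc; _+_; _*_; NonZero)
open import Data.Fin using (Fin; _<?_)
open import Data.Fin.Properties using () renaming (_≟_ to _≟ᶠ_)
open import Data.List using (List; []; _∷_; map; filterᵇ; allFin; cartesianProduct; length; _++_)
open import Data.Nat.ListAction using (sum; product)
open import Data.Product using (_×_; _,_; proj₁; proj₂; ∃)
open import Data.Sum using (_⊎_; inj₁; inj₂)
open import Data.Integer using (+_)
open import Relation.Nullary.Decidable using (⌊_⌋)
open import Relation.Binary.PropositionalEquality using (_≡_)
import Data.Rational as ℚ
open ℚ using (ℚ)

record Graph (n : ℕ) : Set where
  field
    adj    : Fin n → Fin n → Bool
    sym    : ∀ i j → adj i j ≡ adj j i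
    irrefl : ∀ i → adj i i ≡ false
open Graph public

module _ {n : ℕ} (G : Graph n) where

  -- Edges of G: each edge {i,j} listed exactly once as (i , j) with i < j.
  edges : List (Fin n × Fin n)
  edges = filterᵇ (λ p → ⌊ proj₁ p <? proj₂ p ⌋ ∧ adj G (proj₁ p) (proj₂ p))
                  (cartesianProduct (allFin n) (allFin n))

  numEdges : ℕ
  numEdges = length edges

  deg : Fin n → ℕ
  deg v = length (filterᵇ (adj G v) (allFin n))

  M₁ : ℕ
  M₁ = sum (map (λ v → deg v * deg v) (allFin n))

  regular : Set
  regular = ∃ λ k → ∀ v → deg v ≡ k

  -- Total transformation graph G^{---}: vertex set V(G) ⊎ E(G).
  TVertex : Set
  TVertex = Fin n ⊎ (Fin n × Fin n)

  tVertices : List TVertex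
  tVertices = map inj₁ (allFin n) ++ map inj₂ edges

  incident : Fin n → Fin n × Fin n → Bool
  incident u (a , b) = ⌊ u ≟ᶠ a ⌋ ∨ ⌊ u ≟ᶠ b ⌋

  tAdj : TVertex → TVertex → Bool
  tAdj (inj₁ u) (inj₁ v) = not ⌊ u ≟ᶠ v ⌋ ∧ not (adj G u v)
  -- edges of G sharing no endpoint (automatically distinct)
  tAdj (inj₂ e) (inj₂ (a , b)) = not (incident a e) ∧ not (incident b e)
  tAdj (inj₁ u) (inj₂ e) = not (incident u e)
  tAdj (inj₂ e) (inj₁ u) = not (incident u e)

  tDeg : TVertex → ℕ
  tDeg x = length (filterᵇ (tAdj x) tVertices)

  NKmmm : ℕ
  NKmmm = product (map tDeg tVertices)

ℕ→ℚ : ℕ → ℚ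
ℕ→ℚ k = (+ k) ℚ./ 1

_^ℚ_ : ℚ → ℕ → ℚ
q ^ℚ zero = ℚ.1ℚ
q ^ℚ suc k = q ℚ.* (q ^ℚ k)

bound : (n m M : ℕ) → {{NonZero n}} → {{NonZero m}} → ℚ
bound n m M =
  ((base ℚ.- ((+ (4 * m)) ℚ./ n)) ^ℚ n) ℚ.* ((base ℚ.- ((+ M) ℚ./ m)) ^ℚ m)
  where
  base : ℚ
  base = (ℕ→ℚ m ℚ.+ ℕ→ℚ n) ℚ.- ℚ.1ℚ

module Submission where

open import Defs hiding (sym)
open import Algebra.Bundles using (CommutativeMonoid)
open import Data.Bool using (Bool; true; false; not; _∧_; _∨_; if_then_else_)
open import Data.Bool.Properties using (T-≡)
open import Data.Fin as Fin using (Fin)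
import Data.Fin.Properties as Finₚ
import Data.Integer as ℤ
import Data.Integer.Properties as ℤ
open import Data.List using (List; []; _∷_; map; filterᵇ; allFin; cartesianProduct; length; _++_)
import Data.List.Properties as Listₚ
open import Data.List.Relation.Unary.All as All using (All; []; _∷_)
import Data.List.Relation.Unary.All.Properties as Allₚ
open import Data.Nat using (ℕ; zero; suc; _+_; _*_; _∸_; _^_; _≤_; _<_; z≤n; z<s; NonZero; ≢-nonZero; >-nonZero⁻¹)
open import Data.Nat.Coprimality using (1-coprimeTo)
import Data.Nat.Coprimality as Coprimality
open import Data.Nat.ListAction using (sum; product)
import Data.Nat.ListAction.Properties as ListActionₚ
open import Data.Nat.Properties
open import Data.Nat.Tactic.RingSolver using (solve-∀)
open import Data.Product using (∃; _×_; _,_; proj₁; proj₂)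
open import Data.Rational as ℚ using (ℚ; mkℚ; _/_; 1ℚ)
import Data.Rational.Properties as ℚ
open import Data.Rational.Solver using (module +-*-Solver)
import Data.Rational.Unnormalised as ℚᵘ
import Data.Rational.Unnormalised.Properties as ℚᵘ
open import Data.Sum using (_⊎_; inj₁; inj₂; [_,_]′)
open import Function using (_∘_; id)
open import Function.Bundles using (_⇔_; mk⇔; Equivalence)
open import Function.Construct.Composition using (_⇔-∘_)
open import Relation.Binary using (tri<; tri≈; tri>)
open import Relation.Binary.PropositionalEquality
open import Relation.Nullary using (yes; no; contradiction)
open import Relation.Nullary.Decidable using (⌊_⌋)
open import Relation.Nullary.Decidable.Core using (T?)
open import Algebra.Properties.CommutativeSemigroup +-commutativeSemigroup
  using () renaming (interchange to +-interchange)
open import Algebra.Properties.CommutativeSemigroup *-commutativeSemigroup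
  using () renaming (interchange to *-interchange; x∙yz≈y∙xz to *-leftSwap)
open import Algebra.Properties.CommutativeSemigroup (CommutativeMonoid.commutativeSemigroup ℚ.*-1-commutativeMonoid)
  using () renaming (interchange to ℚ-*-interchange)
open +-*-Solver using (solve; _:+_; _:-_; _:*_; _:=_; con)

-- In G^{---} a vertex u is adjacent to the n − 1 − d(u) vertices and the m − d(u) edges that
-- avoid it, and an edge uv to the n − 2 vertices and, by inclusion–exclusion, the
-- m + 1 − d(u) − d(v) edges that avoid it. Summing, the vertex degrees of G^{---} add up to
-- n(m + n − 1) − 4m and the edge degrees to m(m + n − 1) − M₁(G), so after clearing the
-- denominators nⁿmᵐ the bound is the product of the AM–GM inequalities for these two degree
-- sequences. Equality in the vertex inequality makes all d(u) equal; equality can also hold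
-- because the edge sum vanishes, but then some edge avoids nothing, which forces G = K₂.
-- A regular G makes both degree sequences constant.

-- Finite sums and indicators

∑ : {A : Set} → List A → (A → ℕ) → ℕ
∑ xs f = sum (map f xs)

syntax ∑ xs (λ x → e) = ∑[ x ∈ xs ] e

𝟙 : Bool → ℕ
𝟙 b = if b then 1 else 0

𝟙-not : ∀ x → 𝟙 (not x) + 𝟙 x ≡ 1
𝟙-not true  = refl
𝟙-not false = refl

𝟙-not≡0 : ∀ {x} → 𝟙 (not x) ≡ 0 → x ≡ true
𝟙-not≡0 {true} _ = refl

𝟙-∧ : ∀ x y → 𝟙 (x ∧ y) ≡ 𝟙 x * 𝟙 y
𝟙-∧ true  y = sym (+-identityʳ (𝟙 y))
𝟙-∧ false y = refl

𝟙-∨ : ∀ x y → x ∧ y ≡ false → 𝟙 (x ∨ y) ≡ 𝟙 x + 𝟙 y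
𝟙-∨ true  false _ = refl
𝟙-∨ false y     _ = refl

𝟙-not∧not : ∀ x y → 𝟙 (not x ∧ not y) + (𝟙 x + 𝟙 y) ≡ 1 + 𝟙 (x ∧ y)
𝟙-not∧not true  true  = refl
𝟙-not∧not true  false = refl
𝟙-not∧not false true  = refl
𝟙-not∧not false false = refl

sum≡0⇒All≡0 : ∀ xs → sum xs ≡ 0 → All (_≡ 0) xs
sum≡0⇒All≡0 []       _  = []
sum≡0⇒All≡0 (x ∷ xs) eq = m+n≡0⇒m≡0 x eq ∷ sum≡0⇒All≡0 xs (m+n≡0⇒n≡0 x eq)

∑-map : ∀ {A B : Set} (g : A → B) xs (f : B → ℕ) → ∑ (map g xs) f ≡ ∑ xs (f ∘ g)
∑-map g xs f = cong sum (sym (Listₚ.map-∘ {g = f} {f = g} xs))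

module _ {A : Set} where

  All⇒∃ : ∀ {P : A → Set} {xs} .{{_ : NonZero (length xs)}} → All P xs → ∃ P
  All⇒∃ {xs = x ∷ _} (px ∷ _) = x , px

  ∑-cong : ∀ xs {f g : A → ℕ} → (∀ x → f x ≡ g x) → ∑ xs f ≡ ∑ xs g
  ∑-cong []       f≗g = refl
  ∑-cong (x ∷ xs) f≗g = cong₂ _+_ (f≗g x) (∑-cong xs f≗g)

  ∑-congᴬ : ∀ {xs} {f g : A → ℕ} → All (λ x → f x ≡ g x) xs → ∑ xs f ≡ ∑ xs g
  ∑-congᴬ []             = refl
  ∑-congᴬ (fx≡gx ∷ f≗g) = cong₂ _+_ fx≡gx (∑-congᴬ f≗g)

  ∑-const : ∀ (xs : List A) c → ∑[ x ∈ xs ] c ≡ length xs * c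
  ∑-const []       c = refl
  ∑-const (x ∷ xs) c = cong (c +_) (∑-const xs c)

  ∑-+ : ∀ xs (f g : A → ℕ) → ∑[ x ∈ xs ] (f x + g x) ≡ ∑ xs f + ∑ xs g
  ∑-+ []       f g = refl
  ∑-+ (x ∷ xs) f g = trans (cong (f x + g x +_) (∑-+ xs f g)) (+-interchange (f x) (g x) _ _)

  ∑-+₃ : ∀ xs (f g h : A → ℕ) → ∑[ x ∈ xs ] (f x + g x + h x) ≡ ∑ xs f + ∑ xs g + ∑ xs h
  ∑-+₃ xs f g h = trans (∑-+ xs _ h) (cong (_+ ∑ xs h) (∑-+ xs f g))

  ∑-*ˡ : ∀ xs c (f : A → ℕ) → ∑[ x ∈ xs ] (c * f x) ≡ c * ∑ xs f
  ∑-*ˡ []       c f = sym (*-zeroʳ c)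
  ∑-*ˡ (x ∷ xs) c f = trans (cong (c * f x +_) (∑-*ˡ xs c f)) (sym (*-distribˡ-+ c (f x) _))

  ∑-complement : ∀ xs (f g : A → ℕ) → (∀ x → f x + g x ≡ 1) → ∑ xs f + ∑ xs g ≡ length xs
  ∑-complement xs f g f+g≡1 =
    trans (sym (∑-+ xs f g)) (trans (∑-cong xs f+g≡1) (trans (∑-const xs 1) (*-identityʳ _)))

  ∑-++ : ∀ xs ys (f : A → ℕ) → ∑ (xs ++ ys) f ≡ ∑ xs f + ∑ ys f
  ∑-++ xs ys f = trans (cong sum (Listₚ.map-++ f xs ys)) (ListActionₚ.sum-++ (map f xs) _)

  length-filterᵇ : ∀ (p : A → Bool) xs → length (filterᵇ p xs) ≡ ∑[ x ∈ xs ] 𝟙 (p x)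
  length-filterᵇ p []       = refl
  length-filterᵇ p (x ∷ xs) with p x
  ... | true  = cong suc (length-filterᵇ p xs)
  ... | false = length-filterᵇ p xs

  ∑-filterᵇ : ∀ (p : A → Bool) xs f → ∑ (filterᵇ p xs) f ≡ ∑[ x ∈ xs ] (𝟙 (p x) * f x)
  ∑-filterᵇ p []       f = refl
  ∑-filterᵇ p (x ∷ xs) f with p x
  ... | true  = cong₂ _+_ (sym (+-identityʳ (f x))) (∑-filterᵇ p xs f)
  ... | false = ∑-filterᵇ p xs f

module _ {A B : Set} where

  ∑-comm : ∀ (xs : List A) (ys : List B) (f : A → B → ℕ) →
           ∑[ x ∈ xs ] ∑[ y ∈ ys ] f x y ≡ ∑[ y ∈ ys ] ∑[ x ∈ xs ] f x y
  ∑-comm []       ys f = sym (trans (∑-const ys 0) (*-zeroʳ (length ys)))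
  ∑-comm (x ∷ xs) ys f = trans (cong (∑ ys (f x) +_) (∑-comm xs ys f)) (sym (∑-+ ys (f x) _))

  ∑-∑-+ : ∀ (xs : List A) (ys : List B) (f g : A → B → ℕ) →
          ∑[ x ∈ xs ] ∑[ y ∈ ys ] (f x y + g x y)
            ≡ ∑[ x ∈ xs ] ∑[ y ∈ ys ] f x y + ∑[ x ∈ xs ] ∑[ y ∈ ys ] g x y
  ∑-∑-+ xs ys f g = trans (∑-cong xs λ x → ∑-+ ys (f x) (g x)) (∑-+ xs _ _)

  ∑-cartesianProduct : ∀ (xs : List A) (ys : List B) (f : A × B → ℕ) →
                       ∑ (cartesianProduct xs ys) f ≡ ∑[ x ∈ xs ] ∑[ y ∈ ys ] f (x , y)
  ∑-cartesianProduct []       ys f = refl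
  ∑-cartesianProduct (x ∷ xs) ys f =
    trans (∑-++ (map (x ,_) ys) _ f) (cong₂ _+_ (∑-map (x ,_) ys f) (∑-cartesianProduct xs ys f))

length-allFin : ∀ n → length (allFin n) ≡ n
length-allFin n = Listₚ.length-tabulate {n = n} id

All-allFin⁺ : ∀ {n} {P : Fin n → Set} → (∀ v → P v) → All P (allFin n)
All-allFin⁺ = Allₚ.tabulate⁺

All-allFin⁻ : ∀ {n} {P : Fin n → Set} → All P (allFin n) → ∀ v → P v
All-allFin⁻ = Allₚ.tabulate⁻

∑-allFin-const : ∀ n c → ∑[ v ∈ allFin n ] c ≡ n * c
∑-allFin-const n c = trans (∑-const (allFin n) c) (cong (_* c) (length-allFin n))

∑-allFin-suc : ∀ n (f : Fin (suc n) → ℕ) → ∑ (allFin (suc n)) f ≡ f Fin.zero + ∑[ v ∈ allFin n ] f (Fin.suc v)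
∑-allFin-suc n f = cong (f Fin.zero +_)
  (trans (cong sum (Listₚ.map-tabulate Fin.suc f)) (sym (cong sum (Listₚ.map-tabulate id (f ∘ Fin.suc)))))

_==_ : ∀ {n} → Fin n → Fin n → Bool
u == v = ⌊ u Finₚ.≟ v ⌋

==-refl : ∀ {n} (u : Fin n) → (u == u) ≡ true
==-refl u with u Finₚ.≟ u
... | yes _   = refl
... | no  u≢u = contradiction refl u≢u

≢⇒==-false : ∀ {n} {u v : Fin n} → u ≢ v → (u == v) ≡ false
≢⇒==-false {u = u} {v} u≢v with u Finₚ.≟ v
... | yes u≡v = contradiction u≡v u≢v
... | no  _   = refl

==⇒≡ : ∀ {n} {u v : Fin n} → (u == v) ≡ true → u ≡ v
==⇒≡ {u = u} {v} u==v with u Finₚ.≟ v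
... | yes u≡v = u≡v

==-sym : ∀ {n} (u v : Fin n) → (u == v) ≡ (v == u)
==-sym u v with u Finₚ.≟ v
... | yes refl = sym (==-refl u)
... | no  u≢v  = sym (≢⇒==-false (u≢v ∘ sym))

==-suc : ∀ {n} (u v : Fin n) → (Fin.suc u == Fin.suc v) ≡ (u == v)
==-suc u v with u Finₚ.≟ v
... | yes _ = refl
... | no  _ = refl

==-∧-false : ∀ {n} {a b : Fin n} → a ≢ b → ∀ v → (v == a) ∧ (v == b) ≡ false
==-∧-false {a = a} {b} a≢b v with v Finₚ.≟ a
... | yes refl = ≢⇒==-false a≢b
... | no  _    = refl

∑-δ : ∀ {n} (u : Fin n) (f : Fin n → ℕ) → ∑[ v ∈ allFin n ] (𝟙 (v == u) * f v) ≡ f u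
∑-δ {suc n} Fin.zero f = begin
  ∑[ v ∈ allFin (suc n) ] (𝟙 (v == Fin.zero) * f v) ≡⟨ ∑-allFin-suc n _ ⟩
  f Fin.zero + 0 + ∑[ v ∈ allFin n ] 0              ≡⟨ cong₂ _+_ (+-identityʳ _) (∑-allFin-const n 0) ⟩
  f Fin.zero + n * 0                                ≡⟨ cong (f Fin.zero +_) (*-zeroʳ n) ⟩
  f Fin.zero + 0                                    ≡⟨ +-identityʳ _ ⟩
  f Fin.zero                                        ∎
  where open ≡-Reasoning
∑-δ {suc n} (Fin.suc u) f = begin
  ∑[ v ∈ allFin (suc n) ] (𝟙 (v == Fin.suc u) * f v)
    ≡⟨ ∑-allFin-suc n (λ v → 𝟙 (v == Fin.suc u) * f v) ⟩
  ∑[ v ∈ allFin n ] (𝟙 (Fin.suc v == Fin.suc u) * f (Fin.suc v))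
    ≡⟨ ∑-cong (allFin n) (λ v → cong (λ b → 𝟙 b * f (Fin.suc v)) (==-suc v u)) ⟩
  ∑[ v ∈ allFin n ] (𝟙 (v == u) * f (Fin.suc v))
    ≡⟨ ∑-δ u (f ∘ Fin.suc) ⟩
  f (Fin.suc u) ∎
  where open ≡-Reasoning

∑-δ-count : ∀ {n} (u : Fin n) → ∑[ v ∈ allFin n ] 𝟙 (v == u) ≡ 1
∑-δ-count {n} u = trans (∑-cong (allFin n) λ v → sym (*-identityʳ _)) (∑-δ u (λ _ → 1))

-- The AM–GM inequality over ℕ

^-distribʳ-* : ∀ m n o → (m * n) ^ o ≡ m ^ o * n ^ o
^-distribʳ-* m n zero    = refl
^-distribʳ-* m n (suc o) = trans (cong (m * n *_) (^-distribʳ-* m n o)) (*-interchange m n (m ^ o) (n ^ o))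

square-gap : ∀ {a b} → a ≤ b → a * a + b * b ≡ 2 * (a * b) + (b ∸ a) * (b ∸ a)
square-gap {a} {b} a≤b =
  subst (λ c → a * a + c * c ≡ 2 * (a * c) + (b ∸ a) * (b ∸ a)) (m+[n∸m]≡n a≤b) (expand a (b ∸ a))
  where
  expand : ∀ a d → a * a + (a + d) * (a + d) ≡ 2 * (a * (a + d)) + d * d
  expand = solve-∀

am-gm₂-gap : ∀ a b → ∃ λ d → (a * a + b * b ≡ 2 * (a * b) + d * d) × (a ≢ b → 0 < d)
am-gm₂-gap a b with ≤-total a b
... | inj₁ a≤b = b ∸ a , square-gap a≤b , λ a≢b → m<n⇒0<n∸m (≤∧≢⇒< a≤b a≢b)
... | inj₂ b≤a = a ∸ b , swap (square-gap b≤a) , λ a≢b → m<n⇒0<n∸m (≤∧≢⇒< b≤a (≢-sym a≢b))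
  where
  swap : ∀ {c} → b * b + a * a ≡ 2 * (b * a) + c → a * a + b * b ≡ 2 * (a * b) + c
  swap {c} eq = trans (+-comm (a * a) (b * b)) (trans eq (cong (λ ab → 2 * ab + c) (*-comm b a)))

am-gm₂ : ∀ a b → 2 * (a * b) + 0 ≤ a * a + b * b
am-gm₂ a b with am-gm₂-gap a b
... | d , eq , _ = subst (2 * (a * b) + 0 ≤_) (sym eq) (+-monoʳ-≤ (2 * (a * b)) z≤n)

am-gm₂-strict : ∀ a b → a ≢ b → 2 * (a * b) + 1 ≤ a * a + b * b
am-gm₂-strict a b a≢b with am-gm₂-gap a b
... | d , eq , d>0 = subst (2 * (a * b) + 1 ≤_) (sym eq) (+-monoʳ-≤ (2 * (a * b)) (*-mono-≤ (d>0 a≢b) (d>0 a≢b)))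

-- The slack s is 0 or 1 for the weak or strict inequality at k + 1: the case k, multiplied
-- by a, is combined with 2ab + s ≤ a² + b² multiplied by (k + 1)bᵏ.
weighted-am-gm-step : ∀ k a b s → 2 * (a * b) + s ≤ a * a + b * b →
                      suc k * a * b ^ k ≤ a ^ suc k + k * b ^ suc k →
                      suc (suc k) * a * b ^ suc k + suc k * b ^ k * s ≤ a ^ suc (suc k) + suc k * b ^ suc (suc k)
weighted-am-gm-step k a b s two-ab ih = +-cancelʳ-≤ (k * a * (b * p)) _ _ (begin
  suc (suc k) * a * (b * p) + suc k * p * s + k * a * (b * p) ≡⟨ expand-lhs k a b p s ⟩
  suc k * p * (2 * (a * b) + s)                               ≤⟨ *-monoʳ-≤ (suc k * p) two-ab ⟩
  suc k * p * (a * a + b * b)                                 ≡⟨ expand-middle k a b p ⟩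
  a * (suc k * a * p) + suc k * (b * (b * p))                 ≤⟨ +-monoˡ-≤ _ (*-monoʳ-≤ a ih) ⟩
  a * (q + k * (b * p)) + suc k * (b * (b * p))               ≡⟨ expand-rhs k a b p q ⟩
  a * q + suc k * (b * (b * p)) + k * a * (b * p)             ∎)
  where
  open ≤-Reasoning
  p q : ℕ
  p = b ^ k
  q = a ^ suc k
  expand-lhs : ∀ k a b p s → suc (suc k) * a * (b * p) + suc k * p * s + k * a * (b * p) ≡ suc k * p * (2 * (a * b) + s)
  expand-lhs = solve-∀
  expand-middle : ∀ k a b p → suc k * p * (a * a + b * b) ≡ a * (suc k * a * p) + suc k * (b * (b * p))
  expand-middle = solve-∀
  expand-rhs : ∀ k a b p q → a * (q + k * (b * p)) + suc k * (b * (b * p)) ≡ a * q + suc k * (b * (b * p)) + k * a * (b * p)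
  expand-rhs = solve-∀

weighted-am-gm : ∀ k a b → suc k * a * b ^ k ≤ a ^ suc k + k * b ^ suc k
weighted-am-gm zero    a b = ≤-reflexive (trans (cong (_* 1) (+-identityʳ a)) (sym (+-identityʳ (a * 1))))
weighted-am-gm (suc k) a b =
  ≤-trans (m≤m+n _ _) (weighted-am-gm-step k a b 0 (am-gm₂ a b) (weighted-am-gm k a b))

weighted-am-gm-strict : ∀ k .{{_ : NonZero k}} a b → a ≢ b → suc k * a * b ^ k < a ^ suc k + k * b ^ suc k
weighted-am-gm-strict (suc k) zero    zero      0≢0 = contradiction refl 0≢0
weighted-am-gm-strict (suc k) (suc a) zero      _   = begin-strict
  suc (suc k) * suc a * 0                       ≡⟨ *-zeroʳ (suc (suc k) * suc a) ⟩
  0                                             <⟨ m^n>0 (suc a) (suc (suc k)) ⟩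
  suc a ^ suc (suc k)                           ≤⟨ m≤m+n _ _ ⟩
  suc a ^ suc (suc k) + suc k * 0 ^ suc (suc k) ∎
  where open ≤-Reasoning
weighted-am-gm-strict (suc k) a       b@(suc _) a≢b =
  <-≤-trans (m<m+n _ (*-mono-< (*-mono-< (z<s {n = k}) (m^n>0 b k)) (z<s {n = 0})))
            (weighted-am-gm-step k a b 1 (am-gm₂-strict a b a≢b) (weighted-am-gm k a b))

-- The weighted inequality at a = k(x + t), b = (k + 1)t.
am-gm-step-identities : ∀ k t x →
  (suc k * (k * (x + t)) * (suc k * t) ^ k ≡ k * (suc k ^ suc k * (x * t ^ k)) + k * (suc k * t) ^ suc k)
  × ((k * (x + t)) ^ suc k ≡ k * (k ^ k * (x + t) ^ suc k))
am-gm-step-identities k t x = lhs , rhs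
  where
  open ≡-Reasoning
  q : ℕ
  q = (suc k * t) ^ k
  expand : ∀ k x t q → suc k * (k * (x + t)) * q ≡ k * (suc k * (x * q)) + k * (suc k * t * q)
  expand = solve-∀
  x*q : x * q ≡ suc k ^ k * (x * t ^ k)
  x*q = trans (cong (x *_) (^-distribʳ-* (suc k) t k)) (*-leftSwap x (suc k ^ k) (t ^ k))
  lhs : suc k * (k * (x + t)) * q ≡ k * (suc k ^ suc k * (x * t ^ k)) + k * (suc k * t) ^ suc k
  lhs = begin
    suc k * (k * (x + t)) * q                         ≡⟨ expand k x t q ⟩
    k * (suc k * (x * q)) + k * (suc k * t * q)       ≡⟨ cong (λ y → k * (suc k * y) + k * (suc k * t * q)) x*q ⟩
    k * (suc k * (suc k ^ k * (x * t ^ k))) + k * (suc k * t * q)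
      ≡⟨ cong (λ y → k * y + k * (suc k * t * q)) (sym (*-assoc (suc k) (suc k ^ k) _)) ⟩
    k * (suc k ^ suc k * (x * t ^ k)) + k * (suc k * t) ^ suc k ∎
  rhs : (k * (x + t)) ^ suc k ≡ k * (k ^ k * (x + t) ^ suc k)
  rhs = trans (^-distribʳ-* k (x + t) (suc k)) (*-assoc k (k ^ k) _)

am-gm-step : ∀ k .{{_ : NonZero k}} t x → suc k ^ suc k * (x * t ^ k) ≤ k ^ k * (x + t) ^ suc k
am-gm-step k t x with am-gm-step-identities k t x
... | lhs , rhs = *-cancelˡ-≤ k (+-cancelʳ-≤ (k * (suc k * t) ^ suc k) _ _
        (subst₂ (λ l r → l ≤ r + k * (suc k * t) ^ suc k) lhs rhs (weighted-am-gm k (k * (x + t)) (suc k * t))))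

am-gm-step-strict : ∀ k .{{_ : NonZero k}} t x → t ≢ k * x →
                    suc k ^ suc k * (x * t ^ k) < k ^ k * (x + t) ^ suc k
am-gm-step-strict k t x t≢kx with am-gm-step-identities k t x
... | lhs , rhs = *-cancelˡ-< k _ _ (+-cancelʳ-< (k * (suc k * t) ^ suc k) _ _
        (subst₂ (λ l r → l < r + k * (suc k * t) ^ suc k) lhs rhs
          (weighted-am-gm-strict k (k * (x + t)) (suc k * t) a≢b)))
  where
  a≢b : k * (x + t) ≢ suc k * t
  a≢b eq = t≢kx (sym (+-cancelʳ-≡ (k * t) _ _ (trans (sym (*-distribˡ-+ k x t)) eq)))

am-gm : ∀ xs → length xs ^ length xs * product xs ≤ sum xs ^ length xs
am-gm []               = ≤-refl
am-gm (x ∷ [])         = ≤-reflexive (trans (+-identityʳ (x * 1)) (cong (_* 1) (sym (+-identityʳ x))))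
am-gm (x ∷ ys@(_ ∷ _)) = *-cancelˡ-≤ (k ^ k) {{m^n≢0 k k}} (begin
  k ^ k * (suc k ^ suc k * (x * product ys)) ≡⟨ *-leftSwap (k ^ k) (suc k ^ suc k) _ ⟩
  suc k ^ suc k * (k ^ k * (x * product ys)) ≡⟨ cong (suc k ^ suc k *_) (*-leftSwap (k ^ k) x _) ⟩
  suc k ^ suc k * (x * (k ^ k * product ys)) ≤⟨ *-monoʳ-≤ (suc k ^ suc k) (*-monoʳ-≤ x (am-gm ys)) ⟩
  suc k ^ suc k * (x * sum ys ^ k)           ≤⟨ am-gm-step k (sum ys) x ⟩
  k ^ k * (x + sum ys) ^ suc k               ∎)
  where
  open ≤-Reasoning
  k : ℕ
  k = length ys

AM-GM-Tight : List ℕ → Set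
AM-GM-Tight xs = length xs ^ length xs * product xs ≡ sum xs ^ length xs

AllMean : List ℕ → Set
AllMean xs = All (λ y → length xs * y ≡ sum xs) xs

private
  ≤-≤-antisym : ∀ {a b c} → a ≤ b → b ≤ c → a ≡ c → a ≡ b × b ≡ c
  ≤-≤-antisym a≤b b≤c refl = ≤-antisym a≤b b≤c , ≤-antisym b≤c a≤b

-- Both steps in the proof of am-gm (x ∷ ys) are tight: the second forces sum ys = k·x,
-- and the first (unless x = 0, when ys = 0 anyway) is AM–GM for ys.
am-gm-tight-∷ : ∀ x ys .{{_ : NonZero (length ys)}} → (AM-GM-Tight ys → AllMean ys) →
                AM-GM-Tight (x ∷ ys) → AllMean (x ∷ ys)
am-gm-tight-∷ x ys ih tight = All.map (λ y≡x → trans (cong (suc k *_) y≡x) (cong (x +_) (sym S≡kx))) (refl ∷ ys≡x)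
  where
  k S c : ℕ
  k = length ys
  S = sum ys
  c = suc k ^ suc k
  instance
    kᵏ≢0 : NonZero (k ^ k)
    kᵏ≢0 = m^n≢0 k k
    c≢0 : NonZero c
    c≢0 = m^n≢0 (suc k) (suc k)
  both-tight : c * (x * (k ^ k * product ys)) ≡ c * (x * S ^ k) × c * (x * S ^ k) ≡ k ^ k * (x + S) ^ suc k
  both-tight = ≤-≤-antisym (*-monoʳ-≤ c (*-monoʳ-≤ x (am-gm ys))) (am-gm-step k S x) (begin
    c * (x * (k ^ k * product ys)) ≡⟨ cong (c *_) (*-leftSwap x (k ^ k) _) ⟩
    c * (k ^ k * (x * product ys)) ≡⟨ *-leftSwap c (k ^ k) _ ⟩
    k ^ k * (c * (x * product ys)) ≡⟨ cong (k ^ k *_) tight ⟩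
    k ^ k * (x + S) ^ suc k        ∎)
    where open ≡-Reasoning
  S≡kx : S ≡ k * x
  S≡kx with S ≟ k * x
  ... | yes S≡kx = S≡kx
  ... | no  S≢kx = contradiction (proj₂ both-tight) (<⇒≢ (am-gm-step-strict k S x S≢kx))
  ys≡x : All (_≡ x) ys
  ys≡x with x ≟ 0
  ... | yes refl = sum≡0⇒All≡0 ys (trans S≡kx (*-zeroʳ k))
  ... | no  x≢0  = All.map (λ ky≡S → *-cancelˡ-≡ _ _ k (trans ky≡S S≡kx))
                     (ih (*-cancelˡ-≡ _ _ x {{≢-nonZero x≢0}} (*-cancelˡ-≡ _ _ c (proj₁ both-tight))))

am-gm-tight : ∀ xs → AM-GM-Tight xs → AllMean xs
am-gm-tight []               _ = []
am-gm-tight (x ∷ [])         _ = trans (+-identityʳ x) (sym (+-identityʳ x)) ∷ []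
am-gm-tight (x ∷ ys@(_ ∷ _))   = am-gm-tight-∷ x ys (am-gm-tight ys)

am-gm-tight-const : ∀ c xs → All (_≡ c) xs → AM-GM-Tight xs
am-gm-tight-const c xs xs≡c = begin
  length xs ^ length xs * product xs     ≡⟨ cong (length xs ^ length xs *_) (product≡ xs xs≡c) ⟩
  length xs ^ length xs * c ^ length xs  ≡⟨ ^-distribʳ-* (length xs) c (length xs) ⟨
  (length xs * c) ^ length xs            ≡⟨ cong (_^ length xs) (sum≡ xs xs≡c) ⟨
  sum xs ^ length xs                     ∎
  where
  open ≡-Reasoning
  product≡ : ∀ xs → All (_≡ c) xs → product xs ≡ c ^ length xs
  product≡ []       []           = refl
  product≡ (x ∷ xs) (x≡c ∷ xs≡c) = cong₂ _*_ x≡c (product≡ xs xs≡c)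
  sum≡ : ∀ xs → All (_≡ c) xs → sum xs ≡ length xs * c
  sum≡ []       []           = refl
  sum≡ (x ∷ xs) (x≡c ∷ xs≡c) = cong₂ _+_ x≡c (sum≡ xs xs≡c)

*-mono-≤-tight : ∀ {a A b B} → a ≤ A → b ≤ B → a * b ≡ A * B → B ≡ 0 ⊎ a ≡ A
*-mono-≤-tight {a} {A} {b} {zero}      a≤A b≤B ab≡AB = inj₁ refl
*-mono-≤-tight {a} {A} {b} {B@(suc _)} a≤A b≤B ab≡AB with <-cmp a A
... | tri< a<A _ _ = contradiction ab≡AB (<⇒≢ (≤-<-trans (*-monoʳ-≤ a b≤B) (*-monoˡ-< B a<A)))
... | tri≈ _ a≡A _ = inj₂ a≡A
... | tri> _ _ A<a = contradiction a≤A (<⇒≱ A<a)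

-- Natural numbers inside ℚ

ℕ→ℚ-mkℚ : ∀ k → ℕ→ℚ k ≡ mkℚ (ℤ.+ k) 0 (Coprimality.sym (1-coprimeTo k))
ℕ→ℚ-mkℚ k = ℚ.normalize-coprime {k} {0} (Coprimality.sym (1-coprimeTo k))

ℕ→ℚ-+ : ∀ a b → ℕ→ℚ (a + b) ≡ ℕ→ℚ a ℚ.+ ℕ→ℚ b
ℕ→ℚ-+ a b rewrite ℕ→ℚ-mkℚ a | ℕ→ℚ-mkℚ b =
  ℚ./-cong {p₁ = ℤ.+ (a + b)} (sym (cong₂ ℤ._+_ (ℤ.*-identityʳ (ℤ.+ a)) (ℤ.*-identityʳ (ℤ.+ b)))) refl

ℕ→ℚ-* : ∀ a b → ℕ→ℚ (a * b) ≡ ℕ→ℚ a ℚ.* ℕ→ℚ b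
ℕ→ℚ-* a b rewrite ℕ→ℚ-mkℚ a | ℕ→ℚ-mkℚ b = ℚ./-cong {p₁ = ℤ.+ (a * b)} (ℤ.pos-* a b) refl

ℕ→ℚ-^ : ∀ a k → ℕ→ℚ (a ^ k) ≡ ℕ→ℚ a ^ℚ k
ℕ→ℚ-^ a zero    = refl
ℕ→ℚ-^ a (suc k) = trans (ℕ→ℚ-* a (a ^ k)) (cong (ℕ→ℚ a ℚ.*_) (ℕ→ℚ-^ a k))

ℕ→ℚ-mono-≤ : ∀ {a b} → a ≤ b → ℕ→ℚ a ℚ.≤ ℕ→ℚ b
ℕ→ℚ-mono-≤ {a} {b} a≤b rewrite ℕ→ℚ-mkℚ a | ℕ→ℚ-mkℚ b =
  ℚ.*≤* (subst₂ ℤ._≤_ (sym (ℤ.*-identityʳ (ℤ.+ a))) (sym (ℤ.*-identityʳ (ℤ.+ b))) (ℤ.+≤+ a≤b))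

ℕ→ℚ-mono-< : ∀ {a b} → a < b → ℕ→ℚ a ℚ.< ℕ→ℚ b
ℕ→ℚ-mono-< {a} {b} a<b rewrite ℕ→ℚ-mkℚ a | ℕ→ℚ-mkℚ b =
  ℚ.*<* (subst₂ ℤ._<_ (sym (ℤ.*-identityʳ (ℤ.+ a))) (sym (ℤ.*-identityʳ (ℤ.+ b))) (ℤ.+<+ a<b))

ℕ→ℚ-injective : ∀ {a b} → ℕ→ℚ a ≡ ℕ→ℚ b → a ≡ b
ℕ→ℚ-injective {a} {b} eq rewrite ℕ→ℚ-mkℚ a | ℕ→ℚ-mkℚ b = ℤ.+-injective (cong ℚ.↥_ eq)

ℕ→ℚ-*-/ : ∀ k x .{{_ : NonZero k}} → ℕ→ℚ k ℚ.* ((ℤ.+ x) / k) ≡ ℕ→ℚ x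
ℕ→ℚ-*-/ (suc k) x = ℚ.toℚᵘ-injective (begin
  ℚ.toℚᵘ (ℕ→ℚ (suc k) ℚ.* ((ℤ.+ x) / suc k))              ≈⟨ ℚ.toℚᵘ-homo-* (ℕ→ℚ (suc k)) _ ⟩
  ℚ.toℚᵘ (ℕ→ℚ (suc k)) ℚᵘ.* ℚ.toℚᵘ ((ℤ.+ x) / suc k)
    ≈⟨ ℚᵘ.*-cong (ℚ.toℚᵘ-cong (ℕ→ℚ-mkℚ (suc k))) (ℚ.toℚᵘ-fromℚᵘ (ℚᵘ.mkℚᵘ (ℤ.+ x) k)) ⟩
  ℚᵘ.mkℚᵘ (ℤ.+ suc k) 0 ℚᵘ.* ℚᵘ.mkℚᵘ (ℤ.+ x) k              ≈⟨ ℚᵘ.*≡* cross ⟩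
  ℚ.toℚᵘ (mkℚ (ℤ.+ x) 0 (Coprimality.sym (1-coprimeTo x))) ≈⟨ ℚ.toℚᵘ-cong (sym (ℕ→ℚ-mkℚ x)) ⟩
  ℚ.toℚᵘ (ℕ→ℚ x)                                           ∎)
  where
  open ℚᵘ.≃-Reasoning
  cross : (ℤ.+ suc k ℤ.* ℤ.+ x) ℤ.* ℤ.+ 1 ≡ ℤ.+ x ℤ.* ℤ.+ (1 * suc k)
  cross = trans (ℤ.*-identityʳ _) (trans (ℤ.*-comm (ℤ.+ suc k) (ℤ.+ x))
            (cong (λ d → ℤ.+ x ℤ.* ℤ.+ d) (sym (*-identityˡ (suc k)))))

^ℚ-distribʳ-* : ∀ p q k → (p ℚ.* q) ^ℚ k ≡ p ^ℚ k ℚ.* q ^ℚ k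
^ℚ-distribʳ-* p q zero    = refl
^ℚ-distribʳ-* p q (suc k) =
  trans (cong ((p ℚ.* q) ℚ.*_) (^ℚ-distribʳ-* p q k)) (ℚ-*-interchange p q (p ^ℚ k) (q ^ℚ k))

bound-factor : ∀ k p q S x .{{_ : NonZero k}} → S + x + k ≡ k * (p + q) →
               ℕ→ℚ k ℚ.* (((ℕ→ℚ p ℚ.+ ℕ→ℚ q) ℚ.- 1ℚ) ℚ.- (ℤ.+ x) / k) ≡ ℕ→ℚ S
bound-factor k p q S x eq = begin
  ℕ→ℚ k ℚ.* (((ℕ→ℚ p ℚ.+ ℕ→ℚ q) ℚ.- 1ℚ) ℚ.- (ℤ.+ x) / k)
    ≡⟨ distribute (ℕ→ℚ k) (ℕ→ℚ p) (ℕ→ℚ q) ((ℤ.+ x) / k) ⟩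
  ℕ→ℚ k ℚ.* (ℕ→ℚ p ℚ.+ ℕ→ℚ q) ℚ.- ℕ→ℚ k ℚ.- ℕ→ℚ k ℚ.* ((ℤ.+ x) / k)
    ≡⟨ cong₂ (λ a b → a ℚ.- ℕ→ℚ k ℚ.- b) k*[p+q] (ℕ→ℚ-*-/ k x) ⟩
  ℕ→ℚ S ℚ.+ ℕ→ℚ x ℚ.+ ℕ→ℚ k ℚ.- ℕ→ℚ k ℚ.- ℕ→ℚ x
    ≡⟨ cancel (ℕ→ℚ S) (ℕ→ℚ x) (ℕ→ℚ k) ⟩
  ℕ→ℚ S ∎
  where
  open ≡-Reasoning
  k*[p+q] : ℕ→ℚ k ℚ.* (ℕ→ℚ p ℚ.+ ℕ→ℚ q) ≡ ℕ→ℚ S ℚ.+ ℕ→ℚ x ℚ.+ ℕ→ℚ k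
  k*[p+q] = begin
    ℕ→ℚ k ℚ.* (ℕ→ℚ p ℚ.+ ℕ→ℚ q) ≡⟨ cong (ℕ→ℚ k ℚ.*_) (ℕ→ℚ-+ p q) ⟨
    ℕ→ℚ k ℚ.* ℕ→ℚ (p + q)       ≡⟨ ℕ→ℚ-* k (p + q) ⟨
    ℕ→ℚ (k * (p + q))           ≡⟨ cong ℕ→ℚ eq ⟨
    ℕ→ℚ (S + x + k)             ≡⟨ trans (ℕ→ℚ-+ (S + x) k) (cong (ℚ._+ ℕ→ℚ k) (ℕ→ℚ-+ S x)) ⟩
    ℕ→ℚ S ℚ.+ ℕ→ℚ x ℚ.+ ℕ→ℚ k  ∎
  distribute : ∀ k p q r → k ℚ.* (((p ℚ.+ q) ℚ.- 1ℚ) ℚ.- r) ≡ k ℚ.* (p ℚ.+ q) ℚ.- k ℚ.- k ℚ.* r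
  distribute = solve 4 (λ k p q r → k :* (((p :+ q) :- con 1ℚ) :- r) := k :* (p :+ q) :- k :- k :* r) refl
  cancel : ∀ s x k → s ℚ.+ x ℚ.+ k ℚ.- k ℚ.- x ≡ s
  cancel = solve 3 (λ s x k → s :+ x :+ k :- k :- x := s) refl

scaled-bound : ∀ n m M Sₙ Sₘ .{{_ : NonZero n}} .{{_ : NonZero m}} →
               Sₙ + 4 * m + n ≡ n * (m + n) → Sₘ + M + m ≡ m * (m + n) →
               ℕ→ℚ (n ^ n * m ^ m) ℚ.* bound n m M ≡ ℕ→ℚ (Sₙ ^ n * Sₘ ^ m)
scaled-bound n m M Sₙ Sₘ eqₙ eqₘ = begin
  ℕ→ℚ (n ^ n * m ^ m) ℚ.* (qₙ ^ℚ n ℚ.* qₘ ^ℚ m)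
    ≡⟨ cong (ℚ._* (qₙ ^ℚ n ℚ.* qₘ ^ℚ m))
            (trans (ℕ→ℚ-* (n ^ n) (m ^ m)) (cong₂ ℚ._*_ (ℕ→ℚ-^ n n) (ℕ→ℚ-^ m m))) ⟩
  (ℕ→ℚ n ^ℚ n ℚ.* ℕ→ℚ m ^ℚ m) ℚ.* (qₙ ^ℚ n ℚ.* qₘ ^ℚ m)
    ≡⟨ ℚ-*-interchange (ℕ→ℚ n ^ℚ n) (ℕ→ℚ m ^ℚ m) (qₙ ^ℚ n) (qₘ ^ℚ m) ⟩
  (ℕ→ℚ n ^ℚ n ℚ.* qₙ ^ℚ n) ℚ.* (ℕ→ℚ m ^ℚ m ℚ.* qₘ ^ℚ m)
    ≡⟨ cong₂ ℚ._*_ (^ℚ-distribʳ-* (ℕ→ℚ n) qₙ n) (^ℚ-distribʳ-* (ℕ→ℚ m) qₘ m) ⟨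
  (ℕ→ℚ n ℚ.* qₙ) ^ℚ n ℚ.* (ℕ→ℚ m ℚ.* qₘ) ^ℚ m
    ≡⟨ cong₂ (λ a b → a ^ℚ n ℚ.* b ^ℚ m) (bound-factor n m n Sₙ (4 * m) eqₙ) (bound-factor m m n Sₘ M eqₘ) ⟩
  ℕ→ℚ Sₙ ^ℚ n ℚ.* ℕ→ℚ Sₘ ^ℚ m
    ≡⟨ trans (ℕ→ℚ-* (Sₙ ^ n) (Sₘ ^ m)) (cong₂ ℚ._*_ (ℕ→ℚ-^ Sₙ n) (ℕ→ℚ-^ Sₘ m)) ⟨
  ℕ→ℚ (Sₙ ^ n * Sₘ ^ m) ∎
  where
  open ≡-Reasoning
  qₙ qₘ : ℚ
  qₙ = ((ℕ→ℚ m ℚ.+ ℕ→ℚ n) ℚ.- 1ℚ) ℚ.- (ℤ.+ (4 * m)) / n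
  qₘ = ((ℕ→ℚ m ℚ.+ ℕ→ℚ n) ℚ.- 1ℚ) ℚ.- (ℤ.+ M) / m

module _ (C N R : ℕ) .{{_ : NonZero C}} {q : ℚ} (Cq≡R : ℕ→ℚ C ℚ.* q ≡ ℕ→ℚ R) where

  private
    instance
      C-positive : ℚ.Positive (ℕ→ℚ C)
      C-positive = ℚ.positive (ℕ→ℚ-mono-< (>-nonZero⁻¹ C))

  scaled-≤ : C * N ≤ R → ℕ→ℚ N ℚ.≤ q
  scaled-≤ CN≤R =
    ℚ.*-cancelˡ-≤-pos (ℕ→ℚ C) (subst₂ ℚ._≤_ (ℕ→ℚ-* C N) (sym Cq≡R) (ℕ→ℚ-mono-≤ CN≤R))

  scaled-≡ : (ℕ→ℚ N ≡ q) ⇔ (C * N ≡ R)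
  scaled-≡ = mk⇔
    (λ N≡q → ℕ→ℚ-injective (trans (ℕ→ℚ-* C N) (trans (cong (ℕ→ℚ C ℚ.*_) N≡q) Cq≡R)))
    (λ CN≡R → ℚ.≤-antisym (scaled-≤ (≤-reflexive CN≡R))
      (ℚ.*-cancelˡ-≤-pos (ℕ→ℚ C)
        (subst₂ ℚ._≤_ (sym Cq≡R) (ℕ→ℚ-* C N) (ℕ→ℚ-mono-≤ (≤-reflexive (sym CN≡R))))))

-- The total transformation graph G^{---}

module _ {n : ℕ} (G : Graph n) where

  private
    V : List (Fin n)
    V = allFin n
    E : List (Fin n × Fin n)
    E = edges G
    m : ℕ
    m = numEdges G

  -- Definitionally the predicate filtering edges G.
  isEdge : Fin n × Fin n → Bool
  isEdge (a , b) = ⌊ a Fin.<? b ⌋ ∧ adj G a b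

  edges-isEdge : All (λ e → isEdge e ≡ true) E
  edges-isEdge = All.map (Equivalence.to T-≡) (Allₚ.all-filter (T? ∘ isEdge) (cartesianProduct V V))

  All-edges⁺ : ∀ {P : Fin n × Fin n → Set} → (∀ {a b} → isEdge (a , b) ≡ true → P (a , b)) → All P E
  All-edges⁺ P-edge = All.map P-edge edges-isEdge

  isEdge⇒< : ∀ {a b} → isEdge (a , b) ≡ true → a Fin.< b
  isEdge⇒< {a} {b} eq with a Fin.<? b
  ... | yes a<b = a<b

  ∑-edges : ∀ f → ∑ E f ≡ ∑[ a ∈ V ] ∑[ b ∈ V ] (𝟙 (isEdge (a , b)) * f (a , b))
  ∑-edges f = trans (∑-filterᵇ isEdge (cartesianProduct V V) f) (∑-cartesianProduct V V _)

  deg≡∑adj : ∀ v → deg G v ≡ ∑[ w ∈ V ] 𝟙 (adj G v w)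
  deg≡∑adj v = length-filterᵇ (adj G v) V

  𝟙-isEdge-orientations : ∀ a b → 𝟙 (isEdge (a , b)) + 𝟙 (isEdge (b , a)) ≡ 𝟙 (adj G a b)
  𝟙-isEdge-orientations a b with a Fin.<? b | b Fin.<? a
  ... | yes a<b | yes b<a = contradiction b<a (Finₚ.<-asym a<b)
  ... | yes _   | no  _   = +-identityʳ _
  ... | no  _   | yes _   = cong 𝟙 (Graph.sym G b a)
  ... | no  a≮b | no  b≮a with Finₚ.<-cmp a b
  ...   | tri< a<b _ _ = contradiction a<b a≮b
  ...   | tri> _ _ b<a = contradiction b<a b≮a
  ...   | tri≈ _ refl _ = cong 𝟙 (sym (Graph.irrefl G a))

  handshake : ∀ (f : Fin n → ℕ) → ∑[ e ∈ E ] (f (proj₁ e) + f (proj₂ e)) ≡ ∑[ v ∈ V ] (f v * deg G v)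
  handshake f = begin
    ∑[ e ∈ E ] (f (proj₁ e) + f (proj₂ e))
      ≡⟨ ∑-edges _ ⟩
    ∑[ a ∈ V ] ∑[ b ∈ V ] (ι a b * (f a + f b))
      ≡⟨ ∑-cong V (λ a → ∑-cong V λ b → *-distribˡ-+ (ι a b) (f a) (f b)) ⟩
    ∑[ a ∈ V ] ∑[ b ∈ V ] (ι a b * f a + ι a b * f b)
      ≡⟨ ∑-∑-+ V V _ _ ⟩
    ∑[ a ∈ V ] ∑[ b ∈ V ] (ι a b * f a) + ∑[ a ∈ V ] ∑[ b ∈ V ] (ι a b * f b)
      ≡⟨ cong (∑[ a ∈ V ] ∑[ b ∈ V ] (ι a b * f a) +_) (∑-comm V V _) ⟩
    ∑[ a ∈ V ] ∑[ b ∈ V ] (ι a b * f a) + ∑[ a ∈ V ] ∑[ b ∈ V ] (ι b a * f a)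
      ≡⟨ ∑-∑-+ V V _ _ ⟨
    ∑[ a ∈ V ] ∑[ b ∈ V ] (ι a b * f a + ι b a * f a)
      ≡⟨ ∑-cong V (λ a → ∑-cong V λ b →
           trans (sym (*-distribʳ-+ (f a) (ι a b) (ι b a))) (cong (_* f a) (𝟙-isEdge-orientations a b))) ⟩
    ∑[ a ∈ V ] ∑[ b ∈ V ] (𝟙 (adj G a b) * f a)
      ≡⟨ ∑-cong V (λ a → trans (∑-cong V λ b → *-comm _ (f a))
                                (trans (∑-*ˡ V (f a) _) (cong (f a *_) (sym (deg≡∑adj a))))) ⟩
    ∑[ v ∈ V ] (f v * deg G v) ∎
    where
    open ≡-Reasoning
    ι : Fin n → Fin n → ℕ
    ι a b = 𝟙 (isEdge (a , b))

  ∑-edges-cong : ∀ {f g : Fin n × Fin n → ℕ} → (∀ {a b} → isEdge (a , b) ≡ true → f (a , b) ≡ g (a , b)) →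
                 ∑ E f ≡ ∑ E g
  ∑-edges-cong f≗g = ∑-congᴬ (All-edges⁺ f≗g)

  isEdge⇒≢ : ∀ {a b} → isEdge (a , b) ≡ true → a ≢ b
  isEdge⇒≢ = Finₚ.<⇒≢ ∘ isEdge⇒<

  𝟙-incident : ∀ {a b} → isEdge (a , b) ≡ true → ∀ v → 𝟙 (incident G v (a , b)) ≡ 𝟙 (v == a) + 𝟙 (v == b)
  𝟙-incident {a} {b} ab v = 𝟙-∨ (v == a) (v == b) (==-∧-false (isEdge⇒≢ ab) v)

  tDeg-split : ∀ x → tDeg G x ≡ ∑[ v ∈ V ] 𝟙 (tAdj G x (inj₁ v)) + ∑[ e ∈ E ] 𝟙 (tAdj G x (inj₂ e))
  tDeg-split x = begin
    length (filterᵇ (tAdj G x) (map inj₁ V ++ map inj₂ E))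
      ≡⟨ length-filterᵇ (tAdj G x) (tVertices G) ⟩
    ∑ (map inj₁ V ++ map inj₂ E) (𝟙 ∘ tAdj G x)
      ≡⟨ ∑-++ (map inj₁ V) _ _ ⟩
    ∑ (map inj₁ V) (𝟙 ∘ tAdj G x) + ∑ (map inj₂ E) (𝟙 ∘ tAdj G x)
      ≡⟨ cong₂ _+_ (∑-map inj₁ V _) (∑-map inj₂ E _) ⟩
    ∑[ v ∈ V ] 𝟙 (tAdj G x (inj₁ v)) + ∑[ e ∈ E ] 𝟙 (tAdj G x (inj₂ e)) ∎
    where open ≡-Reasoning

  incident-count : ∀ u → ∑[ e ∈ E ] 𝟙 (incident G u e) ≡ deg G u
  incident-count u = begin
    ∑[ e ∈ E ] 𝟙 (incident G u e)                  ≡⟨ ∑-edges-cong 𝟙-incident-sym ⟩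
    ∑[ e ∈ E ] (𝟙 (proj₁ e == u) + 𝟙 (proj₂ e == u)) ≡⟨ handshake (λ v → 𝟙 (v == u)) ⟩
    ∑[ v ∈ V ] (𝟙 (v == u) * deg G v)               ≡⟨ ∑-δ u (deg G) ⟩
    deg G u                                          ∎
    where
    open ≡-Reasoning
    𝟙-incident-sym : ∀ {a b} → isEdge (a , b) ≡ true → 𝟙 (incident G u (a , b)) ≡ 𝟙 (a == u) + 𝟙 (b == u)
    𝟙-incident-sym {a} {b} ab =
      trans (𝟙-incident ab u) (cong₂ (λ x y → 𝟙 x + 𝟙 y) (==-sym u a) (==-sym u b))

  nonNeighbour-count : ∀ u → ∑[ v ∈ V ] 𝟙 (tAdj G (inj₁ u) (inj₁ v)) + (deg G u + 1) ≡ n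
  nonNeighbour-count u = begin
    ∑[ v ∈ V ] 𝟙 (tAdj G (inj₁ u) (inj₁ v)) + (deg G u + 1)
      ≡⟨ cong₂ (λ d i → ∑[ v ∈ V ] 𝟙 (tAdj G (inj₁ u) (inj₁ v)) + (d + i))
               (deg≡∑adj u) (sym (∑-δ-count u)) ⟩
    ∑[ v ∈ V ] 𝟙 (tAdj G (inj₁ u) (inj₁ v)) + (∑[ v ∈ V ] 𝟙 (adj G u v) + ∑[ v ∈ V ] 𝟙 (v == u))
      ≡⟨ cong (∑[ v ∈ V ] 𝟙 (tAdj G (inj₁ u) (inj₁ v)) +_) (∑-+ V _ _) ⟨
    ∑[ v ∈ V ] 𝟙 (tAdj G (inj₁ u) (inj₁ v)) + ∑[ v ∈ V ] (𝟙 (adj G u v) + 𝟙 (v == u))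
      ≡⟨ ∑-complement V _ _ partition ⟩
    length V
      ≡⟨ length-allFin n ⟩
    n ∎
    where
    open ≡-Reasoning
    partition : ∀ v → 𝟙 (not (u == v) ∧ not (adj G u v)) + (𝟙 (adj G u v) + 𝟙 (v == u)) ≡ 1
    partition v with u Finₚ.≟ v
    ... | yes refl = cong₂ (λ b c → 𝟙 b + 𝟙 c) (Graph.irrefl G u) (==-refl u)
    ... | no  u≢v  = trans (cong (λ b → 𝟙 (not (adj G u v)) + (𝟙 (adj G u v) + 𝟙 b)) (≢⇒==-false (u≢v ∘ sym)))
                           (trans (cong (𝟙 (not (adj G u v)) +_) (+-identityʳ _)) (𝟙-not (adj G u v)))

  nonIncidentEdge-count : ∀ u → ∑[ e ∈ E ] 𝟙 (tAdj G (inj₁ u) (inj₂ e)) + deg G u ≡ m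
  nonIncidentEdge-count u = begin
    ∑[ e ∈ E ] 𝟙 (not (incident G u e)) + deg G u
      ≡⟨ cong (∑[ e ∈ E ] 𝟙 (not (incident G u e)) +_) (incident-count u) ⟨
    ∑[ e ∈ E ] 𝟙 (not (incident G u e)) + ∑[ e ∈ E ] 𝟙 (incident G u e)
      ≡⟨ ∑-complement E _ _ (𝟙-not ∘ incident G u) ⟩
    m ∎
    where open ≡-Reasoning

  tDeg-vertex : ∀ u → tDeg G (inj₁ u) + 2 * deg G u + 1 ≡ m + n
  tDeg-vertex u = begin
    tDeg G (inj₁ u) + 2 * deg G u + 1           ≡⟨ cong (λ t → t + 2 * deg G u + 1) (tDeg-split (inj₁ u)) ⟩
    nonNeighbours + nonIncident + 2 * deg G u + 1 ≡⟨ regroup nonNeighbours nonIncident (deg G u) ⟩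
    (nonIncident + deg G u) + (nonNeighbours + (deg G u + 1))
      ≡⟨ cong₂ _+_ (nonIncidentEdge-count u) (nonNeighbour-count u) ⟩
    m + n                                       ∎
    where
    open ≡-Reasoning
    nonNeighbours nonIncident : ℕ
    nonNeighbours = ∑[ v ∈ V ] 𝟙 (tAdj G (inj₁ u) (inj₁ v))
    nonIncident   = ∑[ e ∈ E ] 𝟙 (tAdj G (inj₁ u) (inj₂ e))
    regroup : ∀ x y d → x + y + 2 * d + 1 ≡ (y + d) + (x + (d + 1))
    regroup = solve-∀

  nonIncidentVertex-count : ∀ {a b} → isEdge (a , b) ≡ true →
                            ∑[ v ∈ V ] 𝟙 (tAdj G (inj₂ (a , b)) (inj₁ v)) + 2 ≡ n
  nonIncidentVertex-count {a} {b} ab = begin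
    ∑[ v ∈ V ] 𝟙 (not (incident G v (a , b))) + 2
      ≡⟨ cong₂ (λ i j → ∑[ v ∈ V ] 𝟙 (not (incident G v (a , b))) + (i + j)) (∑-δ-count a) (∑-δ-count b) ⟨
    ∑[ v ∈ V ] 𝟙 (not (incident G v (a , b))) + (∑[ v ∈ V ] 𝟙 (v == a) + ∑[ v ∈ V ] 𝟙 (v == b))
      ≡⟨ cong (∑[ v ∈ V ] 𝟙 (not (incident G v (a , b))) +_) (∑-+ V _ _) ⟨
    ∑[ v ∈ V ] 𝟙 (not (incident G v (a , b))) + ∑[ v ∈ V ] (𝟙 (v == a) + 𝟙 (v == b))
      ≡⟨ ∑-complement V _ _ (λ v → trans (cong (𝟙 (not (incident G v (a , b))) +_) (sym (𝟙-incident ab v)))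
                                         (𝟙-not (incident G v (a , b)))) ⟩
    length V
      ≡⟨ length-allFin n ⟩
    n ∎
    where open ≡-Reasoning

  incident-both : ∀ {a b a′ b′} → isEdge (a , b) ≡ true → isEdge (a′ , b′) ≡ true →
                  incident G a′ (a , b) ∧ incident G b′ (a , b) ≡ (a′ == a) ∧ (b′ == b)
  incident-both {a} {b} {a′} {b′} ab a′b′ with a′ Finₚ.≟ a
  ... | yes refl = cong (_∨ (b′ == b)) (≢⇒==-false (isEdge⇒≢ a′b′ ∘ sym))
  ... | no  _ with a′ Finₚ.≟ b
  ...   | no  _    = refl
  ...   | yes refl = cong₂ _∨_ (≢⇒==-false λ { refl → Finₚ.<-asym (isEdge⇒< ab) (isEdge⇒< a′b′) })
                               (≢⇒==-false (isEdge⇒≢ a′b′ ∘ sym))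

  edge-multiplicity : ∀ {a b} → isEdge (a , b) ≡ true → ∑[ e ∈ E ] 𝟙 ((proj₁ e == a) ∧ (proj₂ e == b)) ≡ 1
  edge-multiplicity {a} {b} ab = begin
    ∑[ e ∈ E ] 𝟙 ((proj₁ e == a) ∧ (proj₂ e == b))
      ≡⟨ ∑-edges _ ⟩
    ∑[ x ∈ V ] ∑[ y ∈ V ] (ι x y * 𝟙 ((x == a) ∧ (y == b)))
      ≡⟨ ∑-cong V (λ x → ∑-cong V λ y →
           trans (cong (ι x y *_) (𝟙-∧ (x == a) (y == b))) (rotate (ι x y) (𝟙 (x == a)) (𝟙 (y == b)))) ⟩
    ∑[ x ∈ V ] ∑[ y ∈ V ] (𝟙 (x == a) * (𝟙 (y == b) * ι x y))
      ≡⟨ ∑-cong V (λ x → ∑-*ˡ V (𝟙 (x == a)) _) ⟩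
    ∑[ x ∈ V ] (𝟙 (x == a) * ∑[ y ∈ V ] (𝟙 (y == b) * ι x y))
      ≡⟨ ∑-cong V (λ x → cong (𝟙 (x == a) *_) (∑-δ b (ι x))) ⟩
    ∑[ x ∈ V ] (𝟙 (x == a) * ι x b)
      ≡⟨ ∑-δ a (λ x → ι x b) ⟩
    ι a b
      ≡⟨ cong 𝟙 ab ⟩
    1 ∎
    where
    open ≡-Reasoning
    ι : Fin n → Fin n → ℕ
    ι x y = 𝟙 (isEdge (x , y))
    rotate : ∀ p q r → p * (q * r) ≡ q * (r * p)
    rotate = solve-∀

  disjointEdge-count : ∀ {a b} → isEdge (a , b) ≡ true →
                       ∑[ e ∈ E ] 𝟙 (tAdj G (inj₂ (a , b)) (inj₂ e)) + (deg G a + deg G b) ≡ m + 1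
  disjointEdge-count {a} {b} ab = begin
    ∑[ e ∈ E ] 𝟙 (tAdj G (inj₂ (a , b)) (inj₂ e)) + (deg G a + deg G b)
      ≡⟨ cong (∑[ e ∈ E ] 𝟙 (tAdj G (inj₂ (a , b)) (inj₂ e)) +_) endpoint-degrees ⟨
    ∑[ e ∈ E ] 𝟙 (tAdj G (inj₂ (a , b)) (inj₂ e)) + ∑[ e ∈ E ] (g (proj₁ e) + g (proj₂ e))
      ≡⟨ ∑-+ E _ _ ⟨
    ∑[ e ∈ E ] (𝟙 (tAdj G (inj₂ (a , b)) (inj₂ e)) + (g (proj₁ e) + g (proj₂ e)))
      ≡⟨ ∑-edges-cong inclusion-exclusion ⟩
    ∑[ e ∈ E ] (1 + 𝟙 ((proj₁ e == a) ∧ (proj₂ e == b)))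
      ≡⟨ ∑-+ E _ _ ⟩
    ∑[ e ∈ E ] 1 + ∑[ e ∈ E ] 𝟙 ((proj₁ e == a) ∧ (proj₂ e == b))
      ≡⟨ cong₂ _+_ (trans (∑-const E 1) (*-identityʳ m)) (edge-multiplicity ab) ⟩
    m + 1 ∎
    where
    open ≡-Reasoning
    g : Fin n → ℕ
    g v = 𝟙 (v == a) + 𝟙 (v == b)
    endpoint-degrees : ∑[ e ∈ E ] (g (proj₁ e) + g (proj₂ e)) ≡ deg G a + deg G b
    endpoint-degrees = begin
      ∑[ e ∈ E ] (g (proj₁ e) + g (proj₂ e))
        ≡⟨ handshake g ⟩
      ∑[ v ∈ V ] ((𝟙 (v == a) + 𝟙 (v == b)) * deg G v)
        ≡⟨ ∑-cong V (λ v → *-distribʳ-+ (deg G v) (𝟙 (v == a)) _) ⟩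
      ∑[ v ∈ V ] (𝟙 (v == a) * deg G v + 𝟙 (v == b) * deg G v)
        ≡⟨ ∑-+ V (λ v → 𝟙 (v == a) * deg G v) _ ⟩
      ∑[ v ∈ V ] (𝟙 (v == a) * deg G v) + ∑[ v ∈ V ] (𝟙 (v == b) * deg G v)
        ≡⟨ cong₂ _+_ (∑-δ a (deg G)) (∑-δ b (deg G)) ⟩
      deg G a + deg G b ∎
    inclusion-exclusion : ∀ {a′ b′} → isEdge (a′ , b′) ≡ true →
      𝟙 (tAdj G (inj₂ (a , b)) (inj₂ (a′ , b′))) + (g a′ + g b′) ≡ 1 + 𝟙 ((a′ == a) ∧ (b′ == b))
    inclusion-exclusion {a′} {b′} a′b′ = begin
      𝟙 (not x ∧ not y) + (g a′ + g b′)
        ≡⟨ cong₂ (λ i j → 𝟙 (not x ∧ not y) + (i + j)) (𝟙-incident ab a′) (𝟙-incident ab b′) ⟨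
      𝟙 (not x ∧ not y) + (𝟙 x + 𝟙 y)   ≡⟨ 𝟙-not∧not x y ⟩
      1 + 𝟙 (x ∧ y)                      ≡⟨ cong (λ c → 1 + 𝟙 c) (incident-both ab a′b′) ⟩
      1 + 𝟙 ((a′ == a) ∧ (b′ == b))      ∎
      where
      x y : Bool
      x = incident G a′ (a , b)
      y = incident G b′ (a , b)

  tDeg-edge : ∀ {a b} → isEdge (a , b) ≡ true → tDeg G (inj₂ (a , b)) + (deg G a + deg G b) + 1 ≡ m + n
  tDeg-edge {a} {b} ab = +-cancelʳ-≡ 1 _ _ (begin
    tDeg G (inj₂ (a , b)) + (deg G a + deg G b) + 1 + 1
      ≡⟨ cong (λ t → t + (deg G a + deg G b) + 1 + 1) (tDeg-split (inj₂ (a , b))) ⟩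
    nonIncident + disjoint + (deg G a + deg G b) + 1 + 1
      ≡⟨ regroup nonIncident disjoint (deg G a + deg G b) ⟩
    (disjoint + (deg G a + deg G b)) + (nonIncident + 2)
      ≡⟨ cong₂ _+_ (disjointEdge-count ab) (nonIncidentVertex-count ab) ⟩
    m + 1 + n
      ≡⟨ shift m n ⟩
    m + n + 1 ∎)
    where
    open ≡-Reasoning
    nonIncident disjoint : ℕ
    nonIncident = ∑[ v ∈ V ] 𝟙 (tAdj G (inj₂ (a , b)) (inj₁ v))
    disjoint    = ∑[ e ∈ E ] 𝟙 (tAdj G (inj₂ (a , b)) (inj₂ e))
    regroup : ∀ x y d → x + y + d + 1 + 1 ≡ (y + d) + (x + 2)
    regroup = solve-∀
    shift : ∀ m n → m + 1 + n ≡ m + n + 1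
    shift = solve-∀

  ∑-deg : ∑ V (deg G) ≡ 2 * m
  ∑-deg = begin
    ∑ V (deg G)              ≡⟨ ∑-cong V (λ v → sym (*-identityˡ (deg G v))) ⟩
    ∑[ v ∈ V ] (1 * deg G v) ≡⟨ handshake (λ _ → 1) ⟨
    ∑[ e ∈ E ] 2             ≡⟨ ∑-const E 2 ⟩
    m * 2                    ≡⟨ *-comm m 2 ⟩
    2 * m                    ∎
    where open ≡-Reasoning

  vertexDegrees edgeDegrees : List ℕ
  vertexDegrees = map (tDeg G) (map inj₁ V)
  edgeDegrees   = map (tDeg G) (map inj₂ E)

  NK-split : NKmmm G ≡ product vertexDegrees * product edgeDegrees
  NK-split = trans (cong product (Listₚ.map-++ (tDeg G) (map inj₁ V) (map inj₂ E)))
                   (ListActionₚ.product-++ vertexDegrees edgeDegrees)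

  length-vertexDegrees : length vertexDegrees ≡ n
  length-vertexDegrees =
    trans (Listₚ.length-map (tDeg G) (map inj₁ V)) (trans (Listₚ.length-map inj₁ V) (length-allFin n))

  length-edgeDegrees : length edgeDegrees ≡ m
  length-edgeDegrees = trans (Listₚ.length-map (tDeg G) (map inj₂ E)) (Listₚ.length-map inj₂ E)

  sum-vertexDegrees : sum vertexDegrees + 4 * m + n ≡ n * (m + n)
  sum-vertexDegrees = begin
    sum vertexDegrees + 4 * m + n
      ≡⟨ cong₂ (λ s i → s + 4 * m + i) (∑-map inj₁ V (tDeg G)) (sym (trans (∑-allFin-const n 1) (*-identityʳ n))) ⟩
    ∑[ v ∈ V ] tDeg G (inj₁ v) + 4 * m + ∑[ v ∈ V ] 1
      ≡⟨ cong (λ d → ∑[ v ∈ V ] tDeg G (inj₁ v) + d + ∑[ v ∈ V ] 1) 4m≡∑2deg ⟩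
    ∑[ v ∈ V ] tDeg G (inj₁ v) + ∑[ v ∈ V ] (2 * deg G v) + ∑[ v ∈ V ] 1
      ≡⟨ ∑-+₃ V _ _ _ ⟨
    ∑[ v ∈ V ] (tDeg G (inj₁ v) + 2 * deg G v + 1)
      ≡⟨ ∑-cong V tDeg-vertex ⟩
    ∑[ v ∈ V ] (m + n)
      ≡⟨ ∑-allFin-const n (m + n) ⟩
    n * (m + n) ∎
    where
    open ≡-Reasoning
    4m≡∑2deg : 4 * m ≡ ∑[ v ∈ V ] (2 * deg G v)
    4m≡∑2deg = trans (*-assoc 2 2 m) (trans (cong (2 *_) (sym ∑-deg)) (sym (∑-*ˡ V 2 (deg G))))

  sum-edgeDegrees : sum edgeDegrees + M₁ G + m ≡ m * (m + n)
  sum-edgeDegrees = begin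
    sum edgeDegrees + M₁ G + m
      ≡⟨ cong₂ (λ s i → s + M₁ G + i) (∑-map inj₂ E (tDeg G)) (sym (trans (∑-const E 1) (*-identityʳ m))) ⟩
    ∑[ e ∈ E ] tDeg G (inj₂ e) + M₁ G + ∑[ e ∈ E ] 1
      ≡⟨ cong (λ d → ∑[ e ∈ E ] tDeg G (inj₂ e) + d + ∑[ e ∈ E ] 1) (handshake (deg G)) ⟨
    ∑[ e ∈ E ] tDeg G (inj₂ e) + ∑[ e ∈ E ] (deg G (proj₁ e) + deg G (proj₂ e)) + ∑[ e ∈ E ] 1
      ≡⟨ ∑-+₃ E _ _ _ ⟨
    ∑[ e ∈ E ] (tDeg G (inj₂ e) + (deg G (proj₁ e) + deg G (proj₂ e)) + 1)
      ≡⟨ ∑-edges-cong tDeg-edge ⟩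
    ∑[ e ∈ E ] (m + n)
      ≡⟨ ∑-const E (m + n) ⟩
    m * (m + n) ∎
    where open ≡-Reasoning

  regular⇒constant-degrees : regular G → ∃ λ c → All (_≡ c) vertexDegrees × All (_≡ c) edgeDegrees
  regular⇒constant-degrees (k , deg≡k) = m + n ∸ (2 * k + 1) , vertexDegrees≡ , edgeDegrees≡
    where
    isolate : ∀ {t} → t + (2 * k + 1) ≡ m + n → t ≡ m + n ∸ (2 * k + 1)
    isolate {t} eq = trans (sym (m+n∸n≡m t (2 * k + 1))) (cong (_∸ (2 * k + 1)) eq)
    vertexDegrees≡ : All (_≡ m + n ∸ (2 * k + 1)) vertexDegrees
    vertexDegrees≡ = Allₚ.map⁺ (Allₚ.map⁺ (All-allFin⁺ λ v → isolate (begin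
      tDeg G (inj₁ v) + (2 * k + 1)       ≡⟨ cong (λ d → tDeg G (inj₁ v) + (2 * d + 1)) (deg≡k v) ⟨
      tDeg G (inj₁ v) + (2 * deg G v + 1) ≡⟨ +-assoc (tDeg G (inj₁ v)) _ 1 ⟨
      tDeg G (inj₁ v) + 2 * deg G v + 1   ≡⟨ tDeg-vertex v ⟩
      m + n                               ∎)))
      where open ≡-Reasoning
    edgeDegrees≡ : All (_≡ m + n ∸ (2 * k + 1)) edgeDegrees
    edgeDegrees≡ = Allₚ.map⁺ (Allₚ.map⁺ (All-edges⁺ λ {a} {b} ab → isolate (begin
      tDeg G (inj₂ (a , b)) + (2 * k + 1)             ≡⟨ regroup (tDeg G (inj₂ (a , b))) k ⟩
      tDeg G (inj₂ (a , b)) + (k + k) + 1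
        ≡⟨ cong₂ (λ x y → tDeg G (inj₂ (a , b)) + (x + y) + 1) (deg≡k a) (deg≡k b) ⟨
      tDeg G (inj₂ (a , b)) + (deg G a + deg G b) + 1 ≡⟨ tDeg-edge ab ⟩
      m + n                                           ∎)))
      where
      open ≡-Reasoning
      regroup : ∀ t k → t + (2 * k + 1) ≡ t + (k + k) + 1
      regroup = solve-∀

  equal-tDeg⇒equal-deg : ∀ u v → tDeg G (inj₁ u) ≡ tDeg G (inj₁ v) → deg G u ≡ deg G v
  equal-tDeg⇒equal-deg u v t≡t = *-cancelˡ-≡ _ _ 2 (+-cancelˡ-≡ (tDeg G (inj₁ v)) _ _ (+-cancelʳ-≡ 1 _ _ (begin
    tDeg G (inj₁ v) + 2 * deg G u + 1 ≡⟨ cong (λ t → t + 2 * deg G u + 1) t≡t ⟨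
    tDeg G (inj₁ u) + 2 * deg G u + 1 ≡⟨ tDeg-vertex u ⟩
    m + n                             ≡⟨ tDeg-vertex v ⟨
    tDeg G (inj₁ v) + 2 * deg G v + 1 ∎)))
    where open ≡-Reasoning

  vertex-am-gm-tight⇒regular : .{{_ : NonZero n}} → AllMean vertexDegrees → regular G
  vertex-am-gm-tight⇒regular mean = deg G v₀ , λ v → equal-tDeg⇒equal-deg v v₀
    (*-cancelˡ-≡ _ _ n (trans (n*tDeg≡S v) (sym (n*tDeg≡S v₀))))
    where
    v₀ : Fin n
    v₀ = Fin.fromℕ< (>-nonZero⁻¹ n)
    n*tDeg≡S : ∀ v → n * tDeg G (inj₁ v) ≡ sum vertexDegrees
    n*tDeg≡S = All-allFin⁻ (Allₚ.map⁻ (Allₚ.map⁻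
      (subst (λ k → All (λ t → k * t ≡ sum vertexDegrees) vertexDegrees) length-vertexDegrees mean)))

  incident⇒endpoint : ∀ {v a b} → incident G v (a , b) ≡ true → v ≡ a ⊎ v ≡ b
  incident⇒endpoint {v} {a} {b} inc with v Finₚ.≟ a
  ... | yes v≡a = inj₁ v≡a
  ... | no  _   = inj₂ (==⇒≡ inc)

  tDeg-edge≡0⇒regular : .{{_ : NonZero m}} → ∀ {a b} → isEdge (a , b) ≡ true →
                        tDeg G (inj₂ (a , b)) ≡ 0 → regular G
  tDeg-edge≡0⇒regular {a} {b} ab t≡0 = 1 , λ v → [ (λ { refl → deg-a≡1 }) , (λ { refl → deg-b≡1 }) ]′ (endpoint v)
    where
    nonIncident≡0 : ∑[ v ∈ V ] 𝟙 (tAdj G (inj₂ (a , b)) (inj₁ v)) ≡ 0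
    nonIncident≡0 = m+n≡0⇒m≡0 _ (trans (sym (tDeg-split (inj₂ (a , b)))) t≡0)
    disjoint≡0 : ∑[ e ∈ E ] 𝟙 (tAdj G (inj₂ (a , b)) (inj₂ e)) ≡ 0
    disjoint≡0 = m+n≡0⇒n≡0 _ (trans (sym (tDeg-split (inj₂ (a , b)))) t≡0)
    endpoint : ∀ v → v ≡ a ⊎ v ≡ b
    endpoint = incident⇒endpoint ∘ 𝟙-not≡0 ∘ All-allFin⁻ (Allₚ.map⁻ (sum≡0⇒All≡0 _ nonIncident≡0))
    n≡2 : n ≡ 2
    n≡2 = trans (sym (nonIncidentVertex-count ab)) (cong (_+ 2) nonIncident≡0)
    deg≤1 : ∀ v → deg G v ≤ 1
    deg≤1 v = +-cancelʳ-≤ 1 _ _ (subst (deg G v + 1 ≤_) (trans (nonNeighbour-count v) n≡2)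
                                       (m≤n+m _ (∑[ w ∈ V ] 𝟙 (tAdj G (inj₁ v) (inj₁ w)))))
    2≤deg-a+deg-b : 2 ≤ deg G a + deg G b
    2≤deg-a+deg-b = subst (2 ≤_) (trans (sym (disjointEdge-count ab)) (cong (_+ (deg G a + deg G b)) disjoint≡0))
                          (+-monoˡ-≤ 1 (>-nonZero⁻¹ m))
    deg-a≡1 : deg G a ≡ 1
    deg-a≡1 = ≤-antisym (deg≤1 a) (+-cancelʳ-≤ 1 1 _ (≤-trans 2≤deg-a+deg-b (+-monoʳ-≤ (deg G a) (deg≤1 b))))
    deg-b≡1 : deg G b ≡ 1
    deg-b≡1 = ≤-antisym (deg≤1 b) (+-cancelˡ-≤ 1 1 _ (≤-trans 2≤deg-a+deg-b (+-monoˡ-≤ (deg G b) (deg≤1 a))))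

  edgeDegrees-vanish⇒regular : .{{_ : NonZero m}} → sum edgeDegrees ≡ 0 → regular G
  edgeDegrees-vanish⇒regular S≡0 =
    let _ , ab , t≡0 = All⇒∃ (All.zip (edges-isEdge , Allₚ.map⁻ (Allₚ.map⁻ (sum≡0⇒All≡0 edgeDegrees S≡0))))
    in tDeg-edge≡0⇒regular ab t≡0

  private
    am-gm-vertices : n ^ n * product vertexDegrees ≤ sum vertexDegrees ^ n
    am-gm-vertices = subst (λ k → k ^ k * product vertexDegrees ≤ sum vertexDegrees ^ k)
                           length-vertexDegrees (am-gm vertexDegrees)

    am-gm-edges : m ^ m * product edgeDegrees ≤ sum edgeDegrees ^ m
    am-gm-edges = subst (λ k → k ^ k * product edgeDegrees ≤ sum edgeDegrees ^ k)
                        length-edgeDegrees (am-gm edgeDegrees)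

    scaled-NK : (n ^ n * m ^ m) * NKmmm G ≡ (n ^ n * product vertexDegrees) * (m ^ m * product edgeDegrees)
    scaled-NK = trans (cong ((n ^ n * m ^ m) *_) NK-split) (*-interchange (n ^ n) (m ^ m) _ _)

  NK-bound : (n ^ n * m ^ m) * NKmmm G ≤ sum vertexDegrees ^ n * sum edgeDegrees ^ m
  NK-bound = subst (_≤ sum vertexDegrees ^ n * sum edgeDegrees ^ m) (sym scaled-NK)
                   (*-mono-≤ am-gm-vertices am-gm-edges)

  NK-bound-tight : .{{_ : NonZero n}} .{{_ : NonZero m}} →
                   ((n ^ n * m ^ m) * NKmmm G ≡ sum vertexDegrees ^ n * sum edgeDegrees ^ m) ⇔ regular G
  NK-bound-tight = mk⇔ to from
    where
    to : (n ^ n * m ^ m) * NKmmm G ≡ sum vertexDegrees ^ n * sum edgeDegrees ^ m → regular G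
    to tight with *-mono-≤-tight am-gm-vertices am-gm-edges (trans (sym scaled-NK) tight)
    ... | inj₁ Sₘᵐ≡0       = edgeDegrees-vanish⇒regular (m^n≡0⇒m≡0 _ m Sₘᵐ≡0)
    ... | inj₂ vertex-tight = vertex-am-gm-tight⇒regular (am-gm-tight vertexDegrees
          (subst (λ k → k ^ k * product vertexDegrees ≡ sum vertexDegrees ^ k) (sym length-vertexDegrees) vertex-tight))
    from : regular G → (n ^ n * m ^ m) * NKmmm G ≡ sum vertexDegrees ^ n * sum edgeDegrees ^ m
    from reg with regular⇒constant-degrees reg
    ... | c , vertices≡c , edges≡c = trans scaled-NK (cong₂ _*_
          (subst (λ k → k ^ k * product vertexDegrees ≡ sum vertexDegrees ^ k) length-vertexDegrees
                 (am-gm-tight-const c vertexDegrees vertices≡c))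
          (subst (λ k → k ^ k * product edgeDegrees ≡ sum edgeDegrees ^ k) length-edgeDegrees
                 (am-gm-tight-const c edgeDegrees edges≡c)))
theorem7 : (n : ℕ) (G : Graph n) {{nzn : NonZero n}} {{nzm : NonZero (numEdges G)}}
    → (ℕ→ℚ (NKmmm G) ℚ.≤ bound n (numEdges G) (M₁ G))
      × ((ℕ→ℚ (NKmmm G) ≡ bound n (numEdges G) (M₁ G)) ⇔ regular G)
theorem7 n G = scaled-≤ C (NKmmm G) R scaled (NK-bound G)
             , NK-bound-tight G ⇔-∘ scaled-≡ C (NKmmm G) R scaled
  where
  m : ℕ
  m = numEdges G
  C R : ℕ
  C = n ^ n * m ^ m
  R = sum (vertexDegrees G) ^ n * sum (edgeDegrees G) ^ m
  instance
    C≢0 : NonZero C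
    C≢0 = m*n≢0 (n ^ n) (m ^ m) {{m^n≢0 n n}} {{m^n≢0 m m}}
  scaled : ℕ→ℚ C ℚ.* bound n m (M₁ G) ≡ ℕ→ℚ R
  scaled = scaled-bound n m (M₁ G) (sum (vertexDegrees G)) (sum (edgeDegrees G)) (sum-vertexDegrees G) (sum-edgeDegrees G)
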